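{- Let $G$ be a finite structure over the signature $\{L,R,U,D,B_V,B_H\}$ ($L,R,U,D$ binary, $B_V,B_H$ unary) which satisfies the sentence $\phi_1$ described in the context, and whose Gaifman graph with respect to $L,R,U,D$ is connected. Suppose there exist an element $v$ of $G$ and a relation $X \in \{L,R,U,D\}$ such that there is no $w$ with $X(v,w)$. Then $G$, restricted to the relations $L,R,U,D$, is isomorphic to a rectangular grid.
   Context: A rectangular grid is a structure $(V,L,R,U,D)$ with $V=\{0,\ldots,x^*\}\times\{0,\ldots,y^*\}$ for some integers $x^*,y^*\ge 0$, where the binary relations hold exactly in the following cases (whenever both vertices exist): $L((x,y),(x-1,y))$, $R((x,y),(x+1,y))$, $U((x,y),(x,y-1))$, $D((x,y),(x,y+1))$. The sentence $\phi_1$ is the conjunction of the following axioms. (Partial functionality) For each $X\in\{L,R,U,D\}$: $\forall x\forall y\forall z\,(X(x,y)\wedge X(x,z)\Rightarrow y=z)$; when it exists, the unique $y$ with $X(x,y)$ is written $X(x)$. (Inverses) $\forall x\forall y\,(R(x,y)\iff L(y,x))$ and $\forall x\forall y\,(U(x,y)\iff D(y,x))$. (Commutativity) For each $H\in\{L,R\}$ and $V\in\{U,D\}$: $\forall x\forall y\forall z\,(H(x,y)\wedge V(x,z)\Rightarrow \exists t\,(H(z,t)\wedge V(y,t)))$. (Horizontal zero) $\forall x\,((\neg\exists y\,U(x,y))\Rightarrow \neg B_V(x))$. (Horizontal increment) $\forall x\,((\exists y\,U(x,y))\Rightarrow ((B_V(x)\not\iff B_V(U(x)))\iff C(x)))$,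 where $C(x)$ is $(\neg\exists y\,L(x,y))\vee(\neg B_V(L(x))\wedge B_V(U(L(x))))$. (No horizontal overflow) $\forall x\,((\neg\exists y\,R(x,y))\Rightarrow\neg B_V(x))$. (Vertical counter, the analogous axioms for $B_H$, counting columns from right to left with least significant bit at the bottom) $\forall x\,((\neg\exists y\,R(x,y))\Rightarrow\neg B_H(x))$; $\forall x\,((\exists y\,R(x,y))\Rightarrow((B_H(x)\not\iff B_H(R(x)))\iff C'(x)))$ where $C'(x)$ is $(\neg\exists y\,D(x,y))\vee(\neg B_H(D(x))\wedge B_H(R(D(x))))$; $\forall x\,((\neg\exists y\,U(x,y))\Rightarrow\neg B_H(x))$. -}

module Defs where

open import Data.Nat using (ℕ; suc)
open import Data.Fin using (Fin; toℕ)
open import Data.Bool using (Bool; true; false)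
open import Data.Product using (Σ; ∃; _×_; _,_)
open import Data.Sum using (_⊎_)
open import Relation.Nullary using (¬_)
open import Relation.Binary.PropositionalEquality using (_≡_)
open import Function.Bundles using (_⇔_; _↔_; Inverse)

record Structure (n : ℕ) : Set where
  field
    L R U D : Fin n → Fin n → Bool
    BV BH   : Fin n → Bool

data Dir : Set where
  dL dR dU dD : Dir

module _ {n : ℕ} (G : Structure n) where
  open Structure G

  rel : Dir → Fin n → Fin n → Bool
  rel dL = L
  rel dR = R
  rel dU = U
  rel dD = D

  Holds : (Fin n → Fin n → Bool) → Fin n → Fin n → Set
  Holds X x y = X x y ≡ true

  Defined : (Fin n → Fin n → Bool) → Fin n → Set
  Defined X x = ∃ λ y → Holds X x y

  PartialFunctional : Set
  PartialFunctional = ∀ (X : Dir) (x y z : Fin n) →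
    Holds (rel X) x y → Holds (rel X) x z → y ≡ z

  Inverses : Set
  Inverses = (∀ x y → Holds R x y ⇔ Holds L y x)
           × (∀ x y → Holds U x y ⇔ Holds D y x)

  Commutes : (Fin n → Fin n → Bool) → (Fin n → Fin n → Bool) → Set
  Commutes H V = ∀ x y z → Holds H x y → Holds V x z →
    ∃ λ t → Holds H z t × Holds V y t

  Commutativity : Set
  Commutativity = Commutes L U × Commutes L D × Commutes R U × Commutes R D

  -- C(x) := (¬∃y L(x,y)) ∨ (¬B_V(L(x)) ∧ B_V(U(L(x))))
  -- (terms L(x), U(L(x)) read existentially: they must exist)
  C : Fin n → Set
  C x = (¬ Defined L x)
      ⊎ (∃ λ l → ∃ λ ul → Holds L x l × Holds U l ul × BV l ≡ false × BV ul ≡ true)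

  C' : Fin n → Set
  C' x = (¬ Defined D x)
       ⊎ (∃ λ d → ∃ λ rd → Holds D x d × Holds R d rd × BH d ≡ false × BH rd ≡ true)

  HorizontalZero : Set
  HorizontalZero = ∀ x → ¬ Defined U x → BV x ≡ false

  HorizontalIncrement : Set
  HorizontalIncrement = ∀ x u → Holds U x u → (¬ (BV x ≡ BV u)) ⇔ C x

  NoHorizontalOverflow : Set
  NoHorizontalOverflow = ∀ x → ¬ Defined R x → BV x ≡ false

  VerticalZero : Set
  VerticalZero = ∀ x → ¬ Defined R x → BH x ≡ false

  VerticalIncrement : Set
  VerticalIncrement = ∀ x r → Holds R x r → (¬ (BH x ≡ BH r)) ⇔ C' x

  NoVerticalOverflow : Set
  NoVerticalOverflow = ∀ x → ¬ Defined U x → BH x ≡ false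

  record Phi1 : Set where
    field
      partialFunctional    : PartialFunctional
      inverses             : Inverses
      commutativity        : Commutativity
      horizontalZero       : HorizontalZero
      horizontalIncrement  : HorizontalIncrement
      noHorizontalOverflow : NoHorizontalOverflow
      verticalZero         : VerticalZero
      verticalIncrement    : VerticalIncrement
      noVerticalOverflow   : NoVerticalOverflow

  GaifmanAdj : Fin n → Fin n → Set
  GaifmanAdj a b = ∃ λ (X : Dir) → Holds (rel X) a b ⊎ Holds (rel X) b a

  data Path : Fin n → Fin n → Set where
    here : ∀ {a} → Path a a
    step : ∀ {a b c} → GaifmanAdj a b → Path b c → Path a c

  GaifmanConnected : Set
  GaifmanConnected = ∀ a b → Path a b

GridPt : ℕ → ℕ → Set
GridPt xs ys = Fin (suc xs) × Fin (suc ys)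

gridRel : ∀ {xs ys} → Dir → GridPt xs ys → GridPt xs ys → Set
gridRel dL (x , y) (x' , y') = toℕ x ≡ suc (toℕ x') × y ≡ y'
gridRel dR (x , y) (x' , y') = suc (toℕ x) ≡ toℕ x' × y ≡ y'
gridRel dU (x , y) (x' , y') = x ≡ x' × toℕ y ≡ suc (toℕ y')
gridRel dD (x , y) (x' , y') = x ≡ x' × suc (toℕ y) ≡ toℕ y'

IsoToGrid : ∀ {n} → Structure n → Set
IsoToGrid {n} G = ∃ λ xs → ∃ λ ys → Σ (Fin n ↔ GridPt xs ys) λ f →
  ∀ (X : Dir) (a b : Fin n) →
    Holds G (rel G X) a b ⇔ gridRel X (Inverse.to f a) (Inverse.to f b)

module Submission where

-- By partial functionality the four relations are partial maps on Fin n;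
-- R,L and U,D are mutually converse and each horizontal map commutes with
-- each vertical one.
--
-- 1. Partial maps: iterates, filling commuting squares, transporting
--    periodicity and undefinedness, and uniqueness of exit times.
-- 2. Finite orbits: by pigeonhole an injective partial map on Fin n either
--    cycles through x or its orbit leaves the domain.
-- 3. The counter argument: in an abstract frame (rows = orbits of a, levels
--    moved by b, a binary digit incremented along rows) rows cannot be
--    periodic.  Otherwise either every point has all four neighbours, or one
--    walks to a bottom level, where the digit is not constant on the row;
--    carries keep it non-constant on every higher row, while on the top row
--    the no-overflow axiom forces it to be 0 everywhere.
-- 4. The model: applying (3) to (R,U,B_H) and (U,R,B_V) shows that all orbits
--    exit.  Walking left and up reaches a corner; the points reached by i
--    steps right and j steps down, within the exit times width and height,
--    are closed under all moves, hence exhaust G by connectedness, and have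
--    unique coordinates.

open import Data.Nat using (ℕ; zero; suc; _+_; _*_; _≤_; _<_; z≤n; s≤s)
open import Data.Nat.Properties
  using (+-identityʳ; +-suc; *-suc; ≤-pred; <⇒≤; <-cmp; n<1+n; m≤n⇒∃[o]m+o≡n; m≤n⇒m<n∨m≡n)
open import Data.Fin using (Fin; toℕ; fromℕ<)
open import Data.Fin.Properties using (pigeonhole; any?; toℕ-injective; toℕ-fromℕ<; toℕ<n; toℕ≤pred[n])
open import Data.Bool using (Bool; true; false)
open import Data.Bool.Properties using () renaming (_≟_ to _≟ᵇ_)
open import Data.Maybe using (Maybe; just; nothing; _>>=_; fromMaybe)
open import Data.Maybe.Properties using (just-injective)
open import Data.Product using (∃; ∃₂; _×_; _,_; proj₁; proj₂)
open import Data.Sum using (_⊎_; inj₁; inj₂)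
open import Data.Empty using (⊥; ⊥-elim)
open import Relation.Nullary using (¬_; yes; no)
open import Relation.Binary.Definitions using (tri<; tri≈; tri>)
open import Relation.Binary.PropositionalEquality
  using (_≡_; refl; sym; trans; cong; cong₂; subst₂; module ≡-Reasoning)
open import Function.Bundles using (_⇔_; _↔_; mk⇔; mk↔ₛ′; Equivalence)
open import Function.Properties.Equivalence using () renaming (sym to ⇔-sym; trans to ⇔-trans)
open import Defs

module PartialMaps {A : Set} where

  Partial : Set
  Partial = A → Maybe A

  IsJust : Maybe A → Set
  IsJust m = ∃ λ z → m ≡ just z

  iter : Partial → ℕ → A → Maybe A
  iter f zero    x = just x
  iter f (suc k) x = iter f k x >>= f

  >>=-just : (m : Maybe A) → (m >>= just) ≡ m
  >>=-just nothing  = refl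
  >>=-just (just x) = refl

  >>=-assoc : (m : Maybe A) (g h : Partial) → ((m >>= g) >>= h) ≡ (m >>= λ y → g y >>= h)
  >>=-assoc nothing  g h = refl
  >>=-assoc (just x) g h = refl

  bind≡just : ∀ (m : Maybe A) (h : Partial) {y} → (m >>= h) ≡ just y →
              ∃ λ z → m ≡ just z × h z ≡ just y
  bind≡just (just z) h e = z , refl , e

  iter-+ : ∀ f i k x → iter f (i + k) x ≡ (iter f i x >>= iter f k)
  iter-+ f i zero    x rewrite +-identityʳ i = sym (>>=-just (iter f i x))
  iter-+ f i (suc k) x rewrite +-suc i k | iter-+ f i k x = >>=-assoc (iter f i x) (iter f k) f

  iter-suc : ∀ f k x → iter f (suc k) x ≡ (f x >>= iter f k)
  iter-suc f k x = iter-+ f 1 k x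

  iter-stuck : ∀ f k m x → iter f k x ≡ nothing → iter f (k + m) x ≡ nothing
  iter-stuck f k m x e rewrite iter-+ f k m x | e = refl

  iter-defined-≤ : ∀ f k i x {y} → iter f k x ≡ just y → i ≤ k → IsJust (iter f i x)
  iter-defined-≤ f k i x e i≤k with iter f i x in eq
  ... | just z  = z , refl
  ... | nothing with m≤n⇒∃[o]m+o≡n i≤k
  ... | d , refl with () ← trans (sym e) (iter-stuck f i d x eq)

  iter-preserves : ∀ (P : A → Set) f → (∀ y z → f y ≡ just z → P y → P z) →
                   ∀ k y z → iter f k y ≡ just z → P y → P z
  iter-preserves P f closed zero y z refl py = py
  iter-preserves P f closed (suc k) y z e py with bind≡just (iter f k y) f e
  ... | u , e₁ , e₂ = closed u z e₂ (iter-preserves P f closed k y u e₁ py)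

  Converse : Partial → Partial → Set
  Converse f g = ∀ x y → f x ≡ just y → g y ≡ just x

  converse-iter : ∀ {f g} → Converse f g → ∀ k x y → iter f k x ≡ just y → iter g k y ≡ just x
  converse-iter conv zero    x y refl = refl
  converse-iter {f} {g} conv (suc k) x y e with bind≡just (iter f k x) f e
  ... | z , e₁ , e₂ rewrite iter-suc g k y | conv z y e₂ = converse-iter conv k x z e₁

  InjectivePartial : Partial → Set
  InjectivePartial f = ∀ a b c → f a ≡ just c → f b ≡ just c → a ≡ b

  converse⇒injective : ∀ {f g} → Converse f g → InjectivePartial f
  converse⇒injective conv a b c e₁ e₂ = just-injective (trans (sym (conv a c e₁)) (conv b c e₂))

  Commute : Partial → Partial → Set
  Commute f g = ∀ x y z → f x ≡ just y → g x ≡ just z → ∃ λ t → f z ≡ just t × g y ≡ just t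

  commute-sym : ∀ {f g} → Commute f g → Commute g f
  commute-sym comm x y z e₁ e₂ with comm x z y e₂ e₁
  ... | t , u , w = t , w , u

  fill-strip : ∀ {f g} → Commute f g → ∀ i x p q → iter f i x ≡ just p → g x ≡ just q →
               ∃ λ t → iter f i q ≡ just t × g p ≡ just t
  fill-strip comm zero x p q refl e = q , refl , e
  fill-strip {f} {g} comm (suc i) x p q e₁ e₂ with bind≡just (iter f i x) f e₁
  ... | p₀ , a , b with fill-strip comm i x p₀ q a e₂
  ... | t₀ , c , d with comm p₀ p t₀ b d
  ... | t , u , w = t , trans (cong (_>>= f) c) u , w

  fill-rectangle : ∀ {f g} → Commute f g → ∀ i j x p q → iter f i x ≡ just p → iter g j x ≡ just q →
                   ∃ λ t → iter f i q ≡ just t × iter g j p ≡ just t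
  fill-rectangle comm i zero x p q e refl = p , e , refl
  fill-rectangle {f} {g} comm i (suc j) x p q e₁ e₂ with bind≡just (iter g j x) g e₂
  ... | q₀ , a , b with fill-rectangle comm i j x p q₀ e₁ a
  ... | t₀ , c , d with fill-strip comm i q₀ t₀ q c b
  ... | t , u , w = t , u , trans (cong (_>>= g) d) w

  Periodic : Partial → A → Set
  Periodic f x = ∃ λ m → iter f (suc m) x ≡ just x

  periodic-transport : ∀ {f g} → Commute f g → ∀ m k x y →
                       iter f (suc m) x ≡ just x → iter g k x ≡ just y → iter f (suc m) y ≡ just y
  periodic-transport comm m k x y per e with fill-rectangle comm (suc m) k x x y per e
  ... | t , u , w = trans u (cong just (just-injective (trans (sym w) e)))

  periodic-step : ∀ f m y z → iter f (suc m) y ≡ just y → f y ≡ just z → iter f (suc m) z ≡ just z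
  periodic-step f m y z per e = begin
    iter f (suc m) z          ≡⟨ cong (_>>= iter f (suc m)) e ⟨
    (f y >>= iter f (suc m))  ≡⟨ iter-suc f (suc m) y ⟨
    (iter f (suc m) y >>= f)  ≡⟨ cong (_>>= f) per ⟩
    f y                       ≡⟨ e ⟩
    just z                    ∎
    where open ≡-Reasoning

  periodic-defined : ∀ f m y → iter f (suc m) y ≡ just y → IsJust (f y)
  periodic-defined f m y per with bind≡just (f y) (iter f m) (trans (sym (iter-suc f m y)) per)
  ... | z , e , _ = z , e

  periodic-predecessor : ∀ {f f'} → Converse f f' → ∀ m y → iter f (suc m) y ≡ just y →
                         ∃ λ u → iter f m y ≡ just u × f' y ≡ just u
  periodic-predecessor {f} conv m y per with bind≡just (iter f m y) f per
  ... | u , a , b = u , a , conv u y b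

  undefined-transport : ∀ {f g g'} → Commute g' f → Converse g g' →
                        ∀ x y → f x ≡ nothing → g x ≡ just y → f y ≡ nothing
  undefined-transport {f} comm conv x y e₁ e₂ with f y in eq
  ... | nothing = refl
  ... | just w with comm y x w (conv x y e₂) eq
  ... | t , _ , b with () ← trans (sym e₁) b

  undefined-along : ∀ {f g g'} → Commute g' f → Converse g g' →
                    ∀ k x y → f x ≡ nothing → iter g k x ≡ just y → f y ≡ nothing
  undefined-along comm conv zero x y e₁ refl = e₁
  undefined-along {g = g} comm conv (suc k) x y e₁ e₂ with bind≡just (iter g k x) g e₂
  ... | z , a , b = undefined-transport comm conv z y (undefined-along comm conv k x z e₁ a) b

  record Exit (f : Partial) (x : A) : Set where
    constructor exit
    field
      time    : ℕ
      last    : A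
      reaches : iter f time x ≡ just last
      stops   : f last ≡ nothing

  iter-past-exit : ∀ f k x y → iter f k x ≡ just y → f y ≡ nothing → ∀ d → iter f (suc k + d) x ≡ nothing
  iter-past-exit f k x y e₁ e₂ d = iter-stuck f (suc k) d x (trans (cong (_>>= f) e₁) e₂)

  exit-time-unique : ∀ {f x} (e e' : Exit f x) → Exit.time e ≡ Exit.time e'
  exit-time-unique {f} {x} (exit k y a b) (exit k' y' c d) with <-cmp k k'
  ... | tri≈ _ k≡k' _ = k≡k'
  ... | tri< k<k' _ _ with m≤n⇒∃[o]m+o≡n k<k'
  ...   | o , refl with () ← trans (sym c) (iter-past-exit f k x y a b o)
  exit-time-unique {f} {x} (exit k y a b) (exit k' y' c d) | tri> _ _ k'<k with m≤n⇒∃[o]m+o≡n k'<k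
  ...   | o , refl with () ← trans (sym a) (iter-past-exit f k' x y' c d o)

  exit-of-undefined : ∀ f k x → iter f k x ≡ nothing → Exit f x
  exit-of-undefined f (suc k) x e with iter f k x in eq
  ... | nothing = exit-of-undefined f k x eq
  ... | just y  = exit k y eq e

  cancel-prefix : ∀ {f} → InjectivePartial f → ∀ a d x z →
                  iter f a x ≡ just z → iter f (a + suc d) x ≡ just z → iter f (suc d) x ≡ just x
  cancel-prefix inj zero d x z refl e = e
  cancel-prefix {f} inj (suc a) d x z e₁ e₂
    with bind≡just (iter f a x) f e₁ | bind≡just (iter f (a + suc d) x) f e₂
  ... | p , p₁ , p₂ | q , q₁ , q₂ with inj p q z p₂ q₂
  ... | refl = cancel-prefix inj a d x p p₁ q₁

module FiniteOrbits {n : ℕ} where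
  open PartialMaps {Fin n}

  periodic-or-exits : ∀ f → InjectivePartial f → ∀ x → Periodic f x ⊎ Exit f x
  periodic-or-exits f inj x with iter f n x in eq
  ... | nothing = inj₂ (exit-of-undefined f n x eq)
  ... | just _  = inj₁ (repetition (pigeonhole (n<1+n n) visit))
    where
    visit : Fin (suc n) → Fin n
    visit i = fromMaybe x (iter f (toℕ i) x)

    visit-correct : ∀ i → iter f (toℕ i) x ≡ just (visit i)
    visit-correct i with iter-defined-≤ f n (toℕ i) x eq (≤-pred (toℕ<n i))
    ... | z , e rewrite e = refl

    repetition : (∃₂ λ i j → toℕ i < toℕ j × visit i ≡ visit j) → Periodic f x
    repetition (i , j , i<j , same) with m≤n⇒∃[o]m+o≡n i<j
    ... | d , i+d≡j = d , cancel-prefix inj (toℕ i) d x (visit i) (visit-correct i) (begin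
      iter f (toℕ i + suc d) x  ≡⟨ cong (λ k → iter f k x) (trans (+-suc (toℕ i) d) i+d≡j) ⟩
      iter f (toℕ j) x          ≡⟨ visit-correct j ⟩
      just (visit j)            ≡⟨ cong just same ⟨
      just (visit i)            ∎)
      where open ≡-Reasoning

  exits-if-aperiodic : ∀ f g → Converse f g → (∀ x → ¬ Periodic f x) → ∀ x → Exit f x
  exits-if-aperiodic f g conv aperiodic x with periodic-or-exits f (converse⇒injective conv) x
  ... | inj₁ per = ⊥-elim (aperiodic x per)
  ... | inj₂ ex  = ex

module Counter {n : ℕ} where
  open PartialMaps {Fin n}
  open FiniteOrbits {n}

  -- Rows are orbits of a, b moves
  -- one level up and b⁻ one level down, a⁻ and b⁻ are converses, and bit is
  -- the digit of a binary counter incremented along each row.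
  record CounterFrame : Set₁ where
    field
      a a⁻ b b⁻ : Partial
      bit       : Fin n → Bool
      a-a⁻      : Converse a a⁻
      b-b⁻      : Converse b b⁻
      b⁻-b      : Converse b⁻ b
      a-b       : Commute a b
      a-b⁻      : Commute a b⁻
      a⁻-b      : Commute a⁻ b
      -- along a the digit flips on the bottom level ...
      flip-bottom : ∀ x y → a x ≡ just y → b⁻ x ≡ nothing → ¬ bit x ≡ bit y
      -- ... and above a carry, i.e. above a step 0 → 1 of the level below
      flip-carry  : ∀ x y l l' → a x ≡ just y → b⁻ x ≡ just l → a l ≡ just l' →
                    bit l ≡ false → bit l' ≡ true → ¬ bit x ≡ bit y
      top-zero  : ∀ x → b x ≡ nothing → bit x ≡ false
      not-torus : (∀ y → IsJust (a y) × IsJust (a⁻ y) × IsJust (b y) × IsJust (b⁻ y)) → ⊥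
      connected : (P : Fin n → Set) →
                  (∀ x y → a x ≡ just y → P x → P y) → (∀ x y → a⁻ x ≡ just y → P x → P y) →
                  (∀ x y → b x ≡ just y → P x → P y) → (∀ x y → b⁻ x ≡ just y → P x → P y) →
                  ∀ x y → P x → P y

  module CounterArgument (F : CounterFrame) where
    open CounterFrame F

    Mixed : Fin n → Set
    Mixed y = ∃ λ w → (∃ λ j → iter a j y ≡ just w) × ¬ bit w ≡ bit y

    Rise : Fin n → Set
    Rise y = ∃ λ j → ∃ λ w → ∃ λ w' →
             iter a j y ≡ just w × a w ≡ just w' × bit w ≡ false × bit w' ≡ true

    rise-between : ∀ i y z → iter a i y ≡ just z → bit y ≡ false → bit z ≡ true → Rise y
    rise-between zero y z refl y0 z1 with () ← trans (sym y0) z1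
    rise-between (suc i) y z e y0 z1 with bind≡just (iter a i y) a e
    ... | u , e₁ , e₂ with bit u in bu
    ... | false = i , u , z , e₁ , e₂ , bu , z1
    ... | true  = rise-between i y u e₁ y0 bu

    iter-period-multiple : ∀ m y → iter a (suc m) y ≡ just y → ∀ k → iter a (k * suc m) y ≡ just y
    iter-period-multiple m y per zero = refl
    iter-period-multiple m y per (suc k) rewrite iter-+ a (suc m) (k * suc m) y | per =
      iter-period-multiple m y per k

    periodic-return : ∀ m y i z → iter a (suc m) y ≡ just y → iter a i y ≡ just z → iter a (i * m) z ≡ just y
    periodic-return m y i z per e = begin
      iter a (i * m) z                  ≡⟨ cong (_>>= iter a (i * m)) e ⟨
      (iter a i y >>= iter a (i * m))   ≡⟨ iter-+ a i (i * m) y ⟨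
      iter a (i + i * m) y              ≡⟨ cong (λ k → iter a k y) (*-suc i m) ⟨
      iter a (i * suc m) y              ≡⟨ iter-period-multiple m y per i ⟩
      just y                            ∎
      where open ≡-Reasoning

    mixed⇒rise : ∀ m y → iter a (suc m) y ≡ just y → Mixed y → Rise y
    mixed⇒rise m y per (z , (i , e) , z≢y) with bit y in by | bit z in bz
    ... | false | false = ⊥-elim (z≢y refl)
    ... | true  | true  = ⊥-elim (z≢y refl)
    ... | false | true  = rise-between i y z e by bz
    ... | true  | false with rise-between (i * m) z y (periodic-return m y i z per e) bz by
    ... | j , w , w' , e₁ , e₂ , w0 , w'1 =
      i + j , w , w' , trans (iter-+ a i j y) (trans (cong (_>>= iter a j) e) e₁) , e₂ , w0 , w'1

    mixed-upward : ∀ m y y' → iter a (suc m) y ≡ just y → Mixed y → b y ≡ just y' → Mixed y'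
    mixed-upward m y y' per mixed up with mixed⇒rise m y per mixed
    ... | j , w , w' , e₁ , e₂ , w0 , w'1 with fill-strip a-b j y w y' e₁ up
    ... | v , f₁ , f₂ with a-b w w' v e₂ f₂
    ... | v' , g₁ , g₂ with bit v ≟ᵇ bit y'
    ... | no  v≢y' = v , (j , f₁) , v≢y'
    ... | yes v≡y' = v' , (suc j , trans (cong (_>>= a) f₁) g₁) ,
                     λ v'≡y' → flip-carry v v' w w' g₁ (b-b⁻ w v f₂) e₂ w0 w'1 (trans v≡y' (sym v'≡y'))

    mixed-at-bottom : ∀ m y → iter a (suc m) y ≡ just y → b⁻ y ≡ nothing → Mixed y
    mixed-at-bottom m y per bottom with periodic-defined a m y per
    ... | z , e = z , (1 , e) , λ z≡y → flip-bottom y z e bottom (sym z≡y)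

    mixed-levels : ∀ m y₀ → iter a (suc m) y₀ ≡ just y₀ → b⁻ y₀ ≡ nothing →
                   ∀ k y → iter b k y₀ ≡ just y → iter a (suc m) y ≡ just y × Mixed y
    mixed-levels m y₀ per bottom zero y refl = per , mixed-at-bottom m y₀ per bottom
    mixed-levels m y₀ per bottom (suc k) y e with bind≡just (iter b k y₀) b e
    ... | u , e₁ , e₂ with mixed-levels m y₀ per bottom k u e₁
    ... | per-u , mixed-u = periodic-transport a-b m 1 u y per-u e₂ , mixed-upward m u y per-u mixed-u e₂

    -- But the top row is constantly 0: a cyclic bottom row with a top is impossible.
    no-cylinder : ∀ m y₀ k t → iter a (suc m) y₀ ≡ just y₀ → b⁻ y₀ ≡ nothing →
                  iter b k y₀ ≡ just t → b t ≡ nothing → ⊥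
    no-cylinder m y₀ k t per bottom e top with mixed-levels m y₀ per bottom k t e
    ... | _ , w , (j , ew) , w≢t =
      w≢t (trans (top-zero w (undefined-along a⁻-b a-a⁻ j t w top ew)) (sym (top-zero t top)))

    DoublyPeriodic : Fin n → Set
    DoublyPeriodic y = Periodic a y × Periodic b⁻ y

    doubly-a : ∀ y z → a y ≡ just z → DoublyPeriodic y → DoublyPeriodic z
    doubly-a y z e ((m , per) , (m' , per')) =
      (m , periodic-step a m y z per e) , (m' , periodic-transport (commute-sym a-b⁻) m' 1 y z per' e)

    doubly-b⁻ : ∀ y z → b⁻ y ≡ just z → DoublyPeriodic y → DoublyPeriodic z
    doubly-b⁻ y z e ((m , per) , (m' , per')) =
      (m , periodic-transport a-b⁻ m 1 y z per e) , (m' , periodic-step b⁻ m' y z per' e)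

    -- Moving backwards along a cycle of length m+1 is moving forwards m steps.
    doubly-a⁻ : ∀ y z → a⁻ y ≡ just z → DoublyPeriodic y → DoublyPeriodic z
    doubly-a⁻ y z e d@((m , per) , _) with periodic-predecessor a-a⁻ m y per
    ... | u , e₁ , e₂ with trans (sym e) e₂
    ... | refl = iter-preserves DoublyPeriodic a doubly-a m y z e₁ d

    doubly-b : ∀ y z → b y ≡ just z → DoublyPeriodic y → DoublyPeriodic z
    doubly-b y z e d@(_ , (m , per)) with periodic-predecessor b⁻-b m y per
    ... | u , e₁ , e₂ with trans (sym e) e₂
    ... | refl = iter-preserves DoublyPeriodic b⁻ doubly-b⁻ m y z e₁ d

    -- A doubly periodic point would make every point doubly periodic, with all neighbours.
    no-torus : ∀ x → DoublyPeriodic x → ⊥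
    no-torus x d = not-torus λ y → all-neighbours y (connected DoublyPeriodic doubly-a doubly-a⁻ doubly-b doubly-b⁻ x y d)
      where
      all-neighbours : ∀ y → DoublyPeriodic y → IsJust (a y) × IsJust (a⁻ y) × IsJust (b y) × IsJust (b⁻ y)
      all-neighbours y ((m , per) , (m' , per')) with periodic-predecessor a-a⁻ m y per | periodic-predecessor b⁻-b m' y per'
      ... | u , _ , e | u' , _ , e' = periodic-defined a m y per , (u , e) , (u' , e') , periodic-defined b⁻ m' y per'

    -- No row is periodic.  Below a cyclic row lies either a
    -- torus or a cyclic bottom row, above which lies a top row.
    no-periodic-row : ∀ x → ¬ Periodic a x
    no-periodic-row x (m , per) with periodic-or-exits b⁻ (converse⇒injective b⁻-b) x
    ... | inj₁ per' = no-torus x ((m , per) , per')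
    ... | inj₂ (exit k y₀ down bottom) with periodic-or-exits b (converse⇒injective b-b⁻) y₀
    ...   | inj₁ (m' , per') with periodic-predecessor b-b⁻ m' y₀ per'
    ...     | _ , _ , e with () ← trans (sym bottom) e
    no-periodic-row x (m , per) | inj₂ (exit k y₀ down bottom) | inj₂ (exit k' t up top) =
      no-cylinder m y₀ k' t (periodic-transport a-b⁻ m k x y₀ per down) bottom up top

grid-mirror-h : ∀ {xs ys} (P Q : GridPt xs ys) → gridRel dR Q P ⇔ gridRel dL P Q
grid-mirror-h (x , y) (x' , y') = mk⇔ (λ (e₁ , e₂) → sym e₁ , sym e₂) (λ (e₁ , e₂) → sym e₁ , sym e₂)

grid-mirror-v : ∀ {xs ys} (P Q : GridPt xs ys) → gridRel dD Q P ⇔ gridRel dU P Q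
grid-mirror-v (x , y) (x' , y') = mk⇔ (λ (e₁ , e₂) → sym e₁ , sym e₂) (λ (e₁ , e₂) → sym e₁ , sym e₂)

module Model {n : ℕ} (G : Structure n) (φ : Phi1 G) where
  open PartialMaps {Fin n}
  open FiniteOrbits {n}
  open Counter {n}
  open Phi1 φ

  Edge : Dir → Fin n → Fin n → Set
  Edge X = Holds G (rel G X)

  move : Dir → Partial
  move X x with any? (λ y → rel G X x y ≟ᵇ true)
  ... | yes (y , _) = just y
  ... | no  _       = nothing

  move-sound : ∀ X x y → move X x ≡ just y → Edge X x y
  move-sound X x y e with any? (λ z → rel G X x z ≟ᵇ true)
  move-sound X x y refl | yes (_ , h) = h
  move-sound X x y ()   | no  _

  move-complete : ∀ X x y → Edge X x y → move X x ≡ just y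
  move-complete X x y h with any? (λ z → rel G X x z ≟ᵇ true)
  ... | yes (z , h') = cong just (partialFunctional X x z y h' h)
  ... | no  none     = ⊥-elim (none (y , h))

  move-undefined : ∀ X x → move X x ≡ nothing → ¬ Defined G (rel G X) x
  move-undefined X x e (y , h) with () ← trans (sym e) (move-complete X x y h)

  right left up down : Partial
  right = move dR
  left  = move dL
  up    = move dU
  down  = move dD

  conv-RL : Converse right left
  conv-RL x y e = move-complete dL y x (Equivalence.to (proj₁ inverses x y) (move-sound dR x y e))

  conv-LR : Converse left right
  conv-LR x y e = move-complete dR y x (Equivalence.from (proj₁ inverses y x) (move-sound dL x y e))

  conv-UD : Converse up down
  conv-UD x y e = move-complete dD y x (Equivalence.to (proj₂ inverses x y) (move-sound dU x y e))

  conv-DU : Converse down up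
  conv-DU x y e = move-complete dU y x (Equivalence.from (proj₂ inverses y x) (move-sound dD x y e))

  commute : ∀ X Y → Commutes G (rel G X) (rel G Y) → Commute (move X) (move Y)
  commute X Y comm x y z e₁ e₂ with comm x y z (move-sound X x y e₁) (move-sound Y x z e₂)
  ... | t , h₁ , h₂ = t , move-complete X z t h₁ , move-complete Y y t h₂

  comm-LU : Commute left up
  comm-LU = commute dL dU (proj₁ commutativity)

  comm-LD : Commute left down
  comm-LD = commute dL dD (proj₁ (proj₂ commutativity))

  comm-RU : Commute right up
  comm-RU = commute dR dU (proj₁ (proj₂ (proj₂ commutativity)))

  comm-RD : Commute right down
  comm-RD = commute dR dD (proj₂ (proj₂ (proj₂ commutativity)))

  opposite : Dir → Dir
  opposite dL = dR
  opposite dR = dL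
  opposite dU = dD
  opposite dD = dU

  edge-opposite : ∀ X a b → Edge X b a → Edge (opposite X) a b
  edge-opposite dL a b h = Equivalence.from (proj₁ inverses a b) h
  edge-opposite dR a b h = Equivalence.to (proj₁ inverses b a) h
  edge-opposite dU a b h = Equivalence.to (proj₂ inverses b a) h
  edge-opposite dD a b h = Equivalence.from (proj₂ inverses a b) h

  along-paths : (P : Fin n → Set) → (∀ X x y → move X x ≡ just y → P x → P y) →
                ∀ x y → Path G x y → P x → P y
  along-paths P closed x .x here px = px
  along-paths P closed x y (step (X , inj₁ h) p) px =
    along-paths P closed _ y p (closed X x _ (move-complete X x _ h) px)
  along-paths P closed x y (step (X , inj₂ h) p) px =
    along-paths P closed _ y p (closed (opposite X) x _ (move-complete (opposite X) x _ (edge-opposite X x _ h)) px)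

  module Rectangle (conn : GaifmanConnected G) (v : Fin n) (X₀ : Dir) (v-missing : ¬ Defined G (rel G X₀) v) where

    connected-induction : (P : Fin n → Set) → (∀ X x y → move X x ≡ just y → P x → P y) → ∀ x y → P x → P y
    connected-induction P closed x y = along-paths P closed x y (conn x y)

    not-torus : (∀ y → IsJust (left y) × IsJust (right y) × IsJust (up y) × IsJust (down y)) → ⊥
    not-torus all = missing X₀ v-missing (all v)
      where
      missing : ∀ X → ¬ Defined G (rel G X) v →
                IsJust (left v) × IsJust (right v) × IsJust (up v) × IsJust (down v) → ⊥
      missing dL none ((z , e) , _ , _ , _) = none (z , move-sound dL v z e)
      missing dR none (_ , (z , e) , _ , _) = none (z , move-sound dR v z e)
      missing dU none (_ , _ , (z , e) , _) = none (z , move-sound dU v z e)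
      missing dD none (_ , _ , _ , (z , e)) = none (z , move-sound dD v z e)

    horizontal : CounterFrame
    horizontal = record
      { a = right ; a⁻ = left ; b = up ; b⁻ = down ; bit = Structure.BH G
      ; a-a⁻ = conv-RL ; b-b⁻ = conv-UD ; b⁻-b = conv-DU
      ; a-b = comm-RU ; a-b⁻ = comm-RD ; a⁻-b = comm-LU
      ; flip-bottom = λ x y e none → Equivalence.from (verticalIncrement x y (move-sound dR x y e))
                                       (inj₁ (move-undefined dD x none))
      ; flip-carry = λ x y l l' e el el' l0 l'1 → Equivalence.from (verticalIncrement x y (move-sound dR x y e))
                       (inj₂ (l , l' , move-sound dD x l el , move-sound dR l l' el' , l0 , l'1))
      ; top-zero = λ x e → noVerticalOverflow x (move-undefined dU x e)
      ; not-torus = λ all → not-torus (λ y → let (r , l , u , d) = all y in l , r , u , d)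
      ; connected = λ P sR sL sU sD → connected-induction P λ { dL → sL ; dR → sR ; dU → sU ; dD → sD }
      }

    vertical : CounterFrame
    vertical = record
      { a = up ; a⁻ = down ; b = right ; b⁻ = left ; bit = Structure.BV G
      ; a-a⁻ = conv-UD ; b-b⁻ = conv-RL ; b⁻-b = conv-LR
      ; a-b = commute-sym comm-RU ; a-b⁻ = commute-sym comm-LU ; a⁻-b = commute-sym comm-RD
      ; flip-bottom = λ x y e none → Equivalence.from (horizontalIncrement x y (move-sound dU x y e))
                                       (inj₁ (move-undefined dL x none))
      ; flip-carry = λ x y l l' e el el' l0 l'1 → Equivalence.from (horizontalIncrement x y (move-sound dU x y e))
                       (inj₂ (l , l' , move-sound dL x l el , move-sound dU l l' el' , l0 , l'1))
      ; top-zero = λ x e → noHorizontalOverflow x (move-undefined dR x e)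
      ; not-torus = λ all → not-torus (λ y → let (u , d , r , l) = all y in l , r , u , d)
      ; connected = λ P sU sD sR sL → connected-induction P λ { dL → sL ; dR → sR ; dU → sU ; dD → sD }
      }

    -- Every orbit of each of the four moves exits.
    -- (abstract: width and height must stay opaque to unification)
    abstract
      exits-right : ∀ x → Exit right x
      exits-right = exits-if-aperiodic right left conv-RL (CounterArgument.no-periodic-row horizontal)

      exits-up : ∀ x → Exit up x
      exits-up = exits-if-aperiodic up down conv-UD (CounterArgument.no-periodic-row vertical)

      exits-left : ∀ x → Exit left x
      exits-left = exits-if-aperiodic left right conv-LR λ x (m , per) →
        CounterArgument.no-periodic-row horizontal x (m , converse-iter conv-LR (suc m) x x per)

      exits-down : ∀ x → Exit down x
      exits-down = exits-if-aperiodic down up conv-DU λ x (m , per) →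
        CounterArgument.no-periodic-row vertical x (m , converse-iter conv-DU (suc m) x x per)

    open Exit (exits-left v) using () renaming (last to left-of-v; stops to left-of-v-stops)
    open Exit (exits-up left-of-v) using () renaming (time to rise; last to corner; reaches to up-to-corner; stops to corner-no-up)

    corner-no-left : left corner ≡ nothing
    corner-no-left = undefined-along (commute-sym comm-LD) conv-UD rise left-of-v corner left-of-v-stops up-to-corner

    open Exit (exits-right corner) public using () renaming (time to width; last to top-right; reaches to to-top-right; stops to top-right-no-right)
    open Exit (exits-down corner) public using () renaming (time to height; last to bottom-left; reaches to to-bottom-left; stops to bottom-left-no-down)

    record Point (i j : ℕ) (x : Fin n) : Set where
      constructor point
      field
        top-cell    : Fin n
        left-cell   : Fin n
        to-top      : iter right i corner ≡ just top-cell
        to-left     : iter down j corner ≡ just left-cell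
        along-row   : iter right i left-cell ≡ just x
        down-column : iter down j top-cell ≡ just x

    point-exists : ∀ i j → i ≤ width → j ≤ height → ∃ (Point i j)
    point-exists i j i≤ j≤
      with iter-defined-≤ right width i corner to-top-right i≤ | iter-defined-≤ down height j corner to-bottom-left j≤
    ... | p , ep | q , eq with fill-rectangle comm-RD i j corner p q ep eq
    ... | t , u , w = t , point p q ep eq u w

    point-unique : ∀ {i j x y} → Point i j x → Point i j y → x ≡ y
    point-unique (point p q ep eq u w) (point p' q' ep' eq' u' w') with just-injective (trans (sym ep) ep')
    ... | refl = just-injective (trans (sym w) w')

    point-via-row : ∀ i j q x → i ≤ width → j ≤ height →
                    iter down j corner ≡ just q → iter right i q ≡ just x → Point i j x
    point-via-row i j q x i≤ j≤ eq ex with point-exists i j i≤ j≤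
    ... | t , point p q' ep eq' u w with just-injective (trans (sym eq) eq')
    ... | refl with just-injective (trans (sym ex) u)
    ... | refl = point p q ep eq ex w

    point-via-column : ∀ i j p x → i ≤ width → j ≤ height →
                       iter right i corner ≡ just p → iter down j p ≡ just x → Point i j x
    point-via-column i j p x i≤ j≤ ep ex with point-exists i j i≤ j≤
    ... | t , point p' q ep' eq u w with just-injective (trans (sym ep) ep')
    ... | refl with just-injective (trans (sym ex) w)
    ... | refl = point p q ep eq u ex

    left-column : ∀ j q → iter down j corner ≡ just q → left q ≡ nothing
    left-column j q eq = undefined-along (commute-sym comm-LU) conv-DU j corner q corner-no-left eq

    top-row : ∀ i p → iter right i corner ≡ just p → up p ≡ nothing
    top-row i p ep = undefined-along comm-LU conv-RL i corner p corner-no-up ep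

    step-right : ∀ {i j x y} → i ≤ width → j ≤ height → Point i j x → right x ≡ just y →
                 i < width × Point (suc i) j y
    step-right {i} {j} {x} {y} i≤ j≤ (point p q ep eq u w) e with m≤n⇒m<n∨m≡n i≤
    ... | inj₁ i< = i< , point-via-row (suc i) j q y i< j≤ eq (trans (cong (_>>= right) u) e)
    ... | inj₂ refl with just-injective (trans (sym ep) to-top-right)
    ... | refl with () ← trans (sym e) (undefined-along (commute-sym comm-RU) conv-DU j p x top-right-no-right w)

    step-down : ∀ {i j x y} → i ≤ width → j ≤ height → Point i j x → down x ≡ just y →
                j < height × Point i (suc j) y
    step-down {i} {j} {x} {y} i≤ j≤ (point p q ep eq u w) e with m≤n⇒m<n∨m≡n j≤
    ... | inj₁ j< = j< , point-via-column i (suc j) p y i≤ j< ep (trans (cong (_>>= down) w) e)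
    ... | inj₂ refl with just-injective (trans (sym eq) to-bottom-left)
    ... | refl with () ← trans (sym e) (undefined-along comm-LD conv-RL i q x bottom-left-no-down u)

    step-left : ∀ {i j x y} → i ≤ width → j ≤ height → Point i j x → left x ≡ just y →
                ∃ λ i' → i ≡ suc i' × Point i' j y
    step-left {zero} {j} i≤ j≤ (point p q ep eq refl w) e with () ← trans (sym e) (left-column j q eq)
    step-left {suc i} {j} {x} {y} i≤ j≤ (point p q ep eq u w) e with bind≡just (iter right i q) right u
    ... | z , e₁ , e₂ with just-injective (trans (sym (conv-RL z x e₂)) e)
    ... | refl = i , refl , point-via-row i j q z (<⇒≤ i≤) j≤ eq e₁

    step-up : ∀ {i j x y} → i ≤ width → j ≤ height → Point i j x → up x ≡ just y →
              ∃ λ j' → j ≡ suc j' × Point i j' y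
    step-up {i} {zero} i≤ j≤ (point p q ep eq u refl) e with () ← trans (sym e) (top-row i p ep)
    step-up {i} {suc j} {x} {y} i≤ j≤ (point p q ep eq u w) e with bind≡just (iter down j p) down w
    ... | z , e₁ , e₂ with just-injective (trans (sym (conv-DU z x e₂)) e)
    ... | refl = j , refl , point-via-column i j p z i≤ (<⇒≤ j≤) ep e₁

    adjacent-right : ∀ {i j x y} → Point i j x → Point (suc i) j y → right x ≡ just y
    adjacent-right (point p q ep eq u w) (point p' q' ep' eq' u' w') with just-injective (trans (sym eq) eq')
    ... | refl = trans (sym (cong (_>>= right) u)) u'

    adjacent-down : ∀ {i j x y} → Point i j x → Point i (suc j) y → down x ≡ just y
    adjacent-down (point p q ep eq u w) (point p' q' ep' eq' u' w') with just-injective (trans (sym ep) ep')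
    ... | refl = trans (sym (cong (_>>= down) w)) w'

    -- The coordinates are the exit times of left and up, hence unique.
    left-exit : ∀ {i j x} → Point i j x → Exit left x
    left-exit {i} {j} {x} (point p q ep eq u w) = exit i q (converse-iter conv-RL i q x u) (left-column j q eq)

    up-exit : ∀ {i j x} → Point i j x → Exit up x
    up-exit {i} {j} {x} (point p q ep eq u w) = exit j p (converse-iter conv-DU j p x w) (top-row i p ep)

    coordinates-unique : ∀ {i j i' j' x} → Point i j x → Point i' j' x → i ≡ i' × j ≡ j'
    coordinates-unique P P' = exit-time-unique (left-exit P) (left-exit P') , exit-time-unique (up-exit P) (up-exit P')

    record Placed (x : Fin n) : Set where
      constructor placed
      field
        col row : ℕ
        col≤    : col ≤ width
        row≤    : row ≤ height
        at      : Point col row x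

    placed-closed : ∀ X x y → move X x ≡ just y → Placed x → Placed y
    placed-closed dR x y e (placed i j i≤ j≤ P) with step-right i≤ j≤ P e
    ... | i< , P' = placed (suc i) j i< j≤ P'
    placed-closed dD x y e (placed i j i≤ j≤ P) with step-down i≤ j≤ P e
    ... | j< , P' = placed i (suc j) i≤ j< P'
    placed-closed dL x y e (placed i j i≤ j≤ P) with step-left i≤ j≤ P e
    ... | i' , refl , P' = placed i' j (<⇒≤ i≤) j≤ P'
    placed-closed dU x y e (placed i j i≤ j≤ P) with step-up i≤ j≤ P e
    ... | j' , refl , P' = placed i j' i≤ (<⇒≤ j≤) P'

    -- By connectedness the rectangle spanned from the corner is all of G.
    -- (abstract: types mentioning coords must not unfold this connectedness proof)
    abstract
      all-placed : ∀ y → Placed y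
      all-placed y = connected-induction Placed placed-closed corner y
                       (placed 0 0 z≤n z≤n (point corner corner refl refl refl refl))

    coords : Fin n → GridPt width height
    coords y = fromℕ< (s≤s col≤) , fromℕ< (s≤s row≤) where open Placed (all-placed y)

    coords-point : ∀ y → Point (toℕ (proj₁ (coords y))) (toℕ (proj₂ (coords y))) y
    coords-point y = subst₂ (λ i j → Point i j y) (sym (toℕ-fromℕ< (s≤s col≤))) (sym (toℕ-fromℕ< (s≤s row≤))) at
      where open Placed (all-placed y)

    cell : GridPt width height → Fin n
    cell (i , j) = proj₁ (point-exists (toℕ i) (toℕ j) (toℕ≤pred[n] i) (toℕ≤pred[n] j))

    cell-point : ∀ Q → Point (toℕ (proj₁ Q)) (toℕ (proj₂ Q)) (cell Q)
    cell-point (i , j) = proj₂ (point-exists (toℕ i) (toℕ j) (toℕ≤pred[n] i) (toℕ≤pred[n] j))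

    grid : Fin n ↔ GridPt width height
    grid = mk↔ₛ′ coords cell coords-cell cell-coords
      where
      coords-cell : ∀ Q → coords (cell Q) ≡ Q
      coords-cell Q with coordinates-unique (coords-point (cell Q)) (cell-point Q)
      ... | e₁ , e₂ = cong₂ _,_ (toℕ-injective e₁) (toℕ-injective e₂)

      cell-coords : ∀ x → cell (coords x) ≡ x
      cell-coords x = point-unique (cell-point (coords x)) (coords-point x)

    right-edge : ∀ a b → Edge dR a b ⇔ gridRel dR (coords a) (coords b)
    right-edge a b = mk⇔ forward backward
      where
      forward : Edge dR a b → gridRel dR (coords a) (coords b)
      forward h with step-right (toℕ≤pred[n] _) (toℕ≤pred[n] _) (coords-point a) (move-complete dR a b h)
      ... | _ , P with coordinates-unique P (coords-point b)
      ... | e₁ , e₂ = e₁ , toℕ-injective e₂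

      backward : gridRel dR (coords a) (coords b) → Edge dR a b
      backward (e₁ , e₂) = move-sound dR a b (adjacent-right (coords-point a)
        (subst₂ (λ i j → Point i j b) (sym e₁) (sym (cong toℕ e₂)) (coords-point b)))

    down-edge : ∀ a b → Edge dD a b ⇔ gridRel dD (coords a) (coords b)
    down-edge a b = mk⇔ forward backward
      where
      forward : Edge dD a b → gridRel dD (coords a) (coords b)
      forward h with step-down (toℕ≤pred[n] _) (toℕ≤pred[n] _) (coords-point a) (move-complete dD a b h)
      ... | _ , P with coordinates-unique P (coords-point b)
      ... | e₁ , e₂ = toℕ-injective e₁ , e₂

      backward : gridRel dD (coords a) (coords b) → Edge dD a b
      backward (e₁ , e₂) = move-sound dD a b (adjacent-down (coords-point a)
        (subst₂ (λ i j → Point i j b) (sym (cong toℕ e₁)) (sym e₂) (coords-point b)))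

    -- Hence all four relations are preserved and reflected, L and U being converses of R and D.
    edges : ∀ X a b → Edge X a b ⇔ gridRel X (coords a) (coords b)
    edges dR a b = right-edge a b
    edges dD a b = down-edge a b
    edges dL a b = ⇔-trans (⇔-sym (proj₁ inverses b a)) (⇔-trans (right-edge b a) (grid-mirror-h (coords a) (coords b)))
    edges dU a b = ⇔-trans (proj₂ inverses a b) (⇔-trans (down-edge b a) (grid-mirror-v (coords a) (coords b)))

theorem1 : ∀ (n : ℕ) (G : Structure n) → Phi1 G → GaifmanConnected G →
    (∃ λ (v : Fin n) → ∃ λ (X : Dir) → ¬ Defined G (rel G X) v) →
    IsoToGrid G
theorem1 n G φ conn (v , X , v-missing) = width , height , grid , edges
  where open Model.Rectangle G φ conn v X v-missing
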